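{- Let $\Gamma$ be a context and $F^A\in\{\Gamma\}$ with $A\equiv[[\Gamma_1],\dots,[\Gamma_n]]$ (the contexts $\Gamma_i$ consisting of variables fresh w.r.t. $\Gamma$). Let $\Theta$ be a context and $k\in\{1,\dots,n\}$ such that the type $[\Gamma_i,\Delta,\Gamma]$ is inhabited for every variable $t^{[\Delta]}\in\{\Theta\}$ and every $i\neq k$. Then $\Theta\le^a\Gamma,\Gamma_k$ implies $\Theta\le^a\Gamma$.
   Context: Simply typed $\lambda$-calculus over base type $0$; every type is uniquely $[B_1,\dots,B_m]:=B_1\to\cdots\to B_m\to0$. A context $\Gamma=x_1^{C_1},\dots,x_k^{C_k}$ is a finite list of distinct typed variables, $\{\Gamma\}$ its set, $[\Gamma]:=[C_1,\dots,C_k]$; every variable's type is written $[\Delta]$ for a context $\Delta$ listing its argument types. A type is inhabited if there is a closed term of that type. Terms identified up to $\beta\eta$ ($=_{\beta\eta}$); $\Lambda^\Xi(A)$ = terms of type $A$ with free variables in $\{\Xi\}$. A substitution $\varrho$ from $\Gamma$ to $\Delta$ assigns $\varrho_c\in\Lambda^\Delta(C)$ to each $c^C\in\{\Gamma\}$; for a fresh context $\Xi$, $\varrho^\Xi$ is $\varrho$ on $\{\Gamma\}$ and the identity on $\{\Xi\}$. $\varrho$ is an atomic reduction if for every fresh $\Xi$, all $a^A,b^B\in\{\Xi,\Gamma\}$ with $A\equiv[A_1,\dots,A_n]$, $B\equiv[B_1,\dots,B_m]$, and all $M_i\in\Lambda^{\Xi,\Delta}(A_i)$, $N_i\in\Lambda^{\Xi,\Delta}(B_i)$: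 $\varrho^\Xi_aM_1\cdots M_n=_{\beta\eta}\varrho^\Xi_bN_1\cdots N_m$ implies $a=b$ and all $M_i=N_i$. $\Theta\le^a\Gamma$ means there is an atomic reduction from $\Theta$ to $\Gamma$. -}

module Defs where

open import Data.List using (List; []; _∷_; _++_; map; length; lookup)
open import Data.List.Relation.Unary.All using (All; []; _∷_)
open import Data.Sum using (_⊎_; inj₁; inj₂)
open import Data.Product using (Σ)

-- Simple types over a single base type 0.  Every type is uniquely
-- [B₁,…,Bₘ] := B₁ → ⋯ → Bₘ → 0, so a type is literally its list of
-- argument types.
data Ty : Set where
  [_] : List Ty → Ty

o : Ty
o = [ [] ]

args : Ty → List Ty
args [ As ] = As

-- Contexts: finite lists of typed variables (de Bruijn; distinctness and
-- freshness are automatic).  [Γ] is  [ Γ ].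
Ctx : Set
Ctx = List Ty

data _∋_ : Ctx → Ty → Set where
  zero : ∀ {Γ A} → (A ∷ Γ) ∋ A
  suc  : ∀ {Γ A B} → Γ ∋ A → (B ∷ Γ) ∋ A

infix 4 _∋_

data Tm (Γ : Ctx) : Ty → Set where
  var : ∀ {A} → Γ ∋ A → Tm Γ A
  app : ∀ {A As} → Tm Γ [ A ∷ As ] → Tm Γ A → Tm Γ [ As ]
  lam : ∀ {A As} → Tm (A ∷ Γ) [ As ] → Tm Γ [ A ∷ As ]

Ren : Ctx → Ctx → Set
Ren Γ Δ = ∀ {A} → Γ ∋ A → Δ ∋ A

Sub : Ctx → Ctx → Set
Sub Γ Δ = ∀ {A} → Γ ∋ A → Tm Δ A

extR : ∀ {Γ Δ B} → Ren Γ Δ → Ren (B ∷ Γ) (B ∷ Δ)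
extR ρ zero    = zero
extR ρ (suc x) = suc (ρ x)

ren : ∀ {Γ Δ A} → Ren Γ Δ → Tm Γ A → Tm Δ A
ren ρ (var x)   = var (ρ x)
ren ρ (app t u) = app (ren ρ t) (ren ρ u)
ren ρ (lam t)   = lam (ren (extR ρ) t)

wk : ∀ {Γ A B} → Tm Γ A → Tm (B ∷ Γ) A
wk = ren suc

extS : ∀ {Γ Δ B} → Sub Γ Δ → Sub (B ∷ Γ) (B ∷ Δ)
extS σ zero    = var zero
extS σ (suc x) = wk (σ x)

sub : ∀ {Γ Δ A} → Sub Γ Δ → Tm Γ A → Tm Δ A
sub σ (var x)   = σ x
sub σ (app t u) = app (sub σ t) (sub σ u)
sub σ (lam t)   = lam (sub (extS σ) t)

sub₀ : ∀ {Γ B} → Tm Γ B → Sub (B ∷ Γ) Γ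
sub₀ u zero    = u
sub₀ u (suc x) = var x

_[_]₀ : ∀ {Γ A B} → Tm (B ∷ Γ) A → Tm Γ B → Tm Γ A
t [ u ]₀ = sub (sub₀ u) t

infix 4 _≈_
data _≈_ : ∀ {Γ A} → Tm Γ A → Tm Γ A → Set where
  ≈refl  : ∀ {Γ A} {t : Tm Γ A} → t ≈ t
  ≈sym   : ∀ {Γ A} {t u : Tm Γ A} → t ≈ u → u ≈ t
  ≈trans : ∀ {Γ A} {t u v : Tm Γ A} → t ≈ u → u ≈ v → t ≈ v
  app-cong : ∀ {Γ A As} {t t' : Tm Γ [ A ∷ As ]} {u u' : Tm Γ A} →
             t ≈ t' → u ≈ u' → app t u ≈ app t' u'
  lam-cong : ∀ {Γ A As} {t t' : Tm (A ∷ Γ) [ As ]} → t ≈ t' → lam t ≈ lam t'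
  β : ∀ {Γ A As} (t : Tm (A ∷ Γ) [ As ]) (u : Tm Γ A) → app (lam t) u ≈ t [ u ]₀
  η : ∀ {Γ A As} (t : Tm Γ [ A ∷ As ]) → lam (app (wk t) (var zero)) ≈ t

Args : Ctx → Ty → Set
Args Γ [ As ] = All (Tm Γ) As

apps : ∀ {Γ A} → Tm Γ A → Args Γ A → Tm Γ o
apps {A = [ [] ]}     h []       = h
apps {A = [ B ∷ Bs ]} h (m ∷ ms) = apps (app h m) ms

data ArgsEq {Γ : Ctx} : ∀ {As} → All (Tm Γ) As → All (Tm Γ) As → Set where
  []  : ArgsEq [] []
  _∷_ : ∀ {A As} {m n : Tm Γ A} {ms ns : All (Tm Γ) As} →
        m ≈ n → ArgsEq ms ns → ArgsEq {As = A ∷ As} (m ∷ ms) (n ∷ ns)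

ArgsEq' : ∀ {Γ} A → Args Γ A → Args Γ A → Set
ArgsEq' [ As ] M N = ArgsEq M N

data SameHeadArgs {Γ Δ : Ctx} : ∀ {A B} → Γ ∋ A → Args Δ A → Γ ∋ B → Args Δ B → Set where
  same : ∀ {A} (a : Γ ∋ A) {M N : Args Δ A} → ArgsEq' A M N → SameHeadArgs a M a N

inl : ∀ {Ξ Γ A} → Ξ ∋ A → (Ξ ++ Γ) ∋ A
inl zero    = zero
inl (suc x) = suc (inl x)

inr : ∀ Ξ {Γ A} → Γ ∋ A → (Ξ ++ Γ) ∋ A
inr []      x = x
inr (B ∷ Ξ) x = suc (inr Ξ x)

split : ∀ Ξ {Γ A} → (Ξ ++ Γ) ∋ A → (Ξ ∋ A) ⊎ (Γ ∋ A)
split []      x       = inj₂ x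
split (B ∷ Ξ) zero    = inj₁ zero
split (B ∷ Ξ) (suc x) with split Ξ x
... | inj₁ y = inj₁ (suc y)
... | inj₂ z = inj₂ z

lift : ∀ Ξ {Γ Δ} → Sub Γ Δ → Sub (Ξ ++ Γ) (Ξ ++ Δ)
lift Ξ ϱ x with split Ξ x
... | inj₁ y = var (inl y)
... | inj₂ z = ren (inr Ξ) (ϱ z)

AtomicReduction : ∀ {Γ Δ} → Sub Γ Δ → Set
AtomicReduction {Γ} {Δ} ϱ =
  ∀ (Ξ : Ctx) {A B} (a : (Ξ ++ Γ) ∋ A) (b : (Ξ ++ Γ) ∋ B)
    (M : Args (Ξ ++ Δ) A) (N : Args (Ξ ++ Δ) B) →
    apps (lift Ξ ϱ a) M ≈ apps (lift Ξ ϱ b) N →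
    SameHeadArgs a M b N

_≤ᵃ_ : Ctx → Ctx → Set
Θ ≤ᵃ Γ = Σ (Sub Θ Γ) AtomicReduction

Inhabited : Ty → Set
Inhabited A = Tm [] A

module Submission where

-- Given an atomic ϱ from Θ to Γ,Γₖ, send t^[Δ] ∈ Θ to  σ t = λΔ. F N₁ ⋯ Nₙ,  where
-- Nₖ = λΓₖ. ϱ_t Δ  and, for i ≠ k,  Nᵢ = λΓᵢ. hᵢ Γᵢ Δ Γ  for a closed inhabitant hᵢ of [Γᵢ,Δ,Γ].
-- In an equation σ^Ξ_a M = σ^Ξ_b N both sides normalise to spines headed by a variable; since
-- a variable of Ξ is never the head F, either a, b ∈ Ξ and the spines are compared directly,
-- or a, b ∈ Θ, and then the k-th arguments of F, stripped of λΓₖ, give an instance of the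
-- atomicity of ϱ whose arguments are those of σ weakened from Ξ,Γ to Ξ,Γ,Γₖ.  The injectivity
-- facts this needs (of head spines, of λ and of injective renamings, all up to βη) come from
-- normalisation by evaluation.

open import Defs
open import Data.List using (List; []; _∷_; _++_; map; length; lookup)
open import Data.List.Relation.Unary.All using (All; []; _∷_; head; tail)
open import Data.Fin using (Fin; zero; suc; _≟_)
open import Data.Sum using (inj₁; inj₂; [_,_]′)
open import Data.Product using (Σ; _,_; proj₁; proj₂; _×_)
open import Data.Empty using (⊥; ⊥-elim)
open import Function using (_∘_; id)
open import Function.Definitions using (Injective)
open import Relation.Nullary using (¬_; yes; no)
open import Relation.Binary.Bundles using (Setoid)
open import Relation.Binary.PropositionalEquality
import Relation.Binary.Reasoning.Setoid as SetoidReasoning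

_≗ʳ_ : ∀ {Γ Δ} → Ren Γ Δ → Ren Γ Δ → Set
ρ ≗ʳ ρ' = ∀ {A} (x : _ ∋ A) → ρ x ≡ ρ' x

_≗ˢ_ : ∀ {Γ Δ} → Sub Γ Δ → Sub Γ Δ → Set
σ ≗ˢ σ' = ∀ {A} (x : _ ∋ A) → σ x ≡ σ' x

extR-cong : ∀ {Γ Δ B} {ρ ρ' : Ren Γ Δ} → ρ ≗ʳ ρ' → extR {B = B} ρ ≗ʳ extR ρ'
extR-cong p zero    = refl
extR-cong p (suc x) = cong suc (p x)

ren-cong : ∀ {Γ Δ A} {ρ ρ' : Ren Γ Δ} → ρ ≗ʳ ρ' → (t : Tm Γ A) → ren ρ t ≡ ren ρ' t
ren-cong p (var x)   = cong var (p x)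
ren-cong p (app t u) = cong₂ app (ren-cong p t) (ren-cong p u)
ren-cong p (lam t)   = cong lam (ren-cong (extR-cong p) t)

extS-cong : ∀ {Γ Δ B} {σ σ' : Sub Γ Δ} → σ ≗ˢ σ' → extS {B = B} σ ≗ˢ extS σ'
extS-cong p zero    = refl
extS-cong p (suc x) = cong wk (p x)

sub-cong : ∀ {Γ Δ A} {σ σ' : Sub Γ Δ} → σ ≗ˢ σ' → (t : Tm Γ A) → sub σ t ≡ sub σ' t
sub-cong p (var x)   = p x
sub-cong p (app t u) = cong₂ app (sub-cong p t) (sub-cong p u)
sub-cong p (lam t)   = cong lam (sub-cong (extS-cong p) t)

ren-id : ∀ {Γ A} (t : Tm Γ A) → ren id t ≡ t
ren-id (var x)   = refl
ren-id (app t u) = cong₂ app (ren-id t) (ren-id u)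
ren-id (lam t)   = cong lam (trans (ren-cong (λ { zero → refl ; (suc x) → refl }) t) (ren-id t))

ren-∘ : ∀ {Γ Δ Ε A} (ρ : Ren Δ Ε) (ρ' : Ren Γ Δ) (t : Tm Γ A) → ren ρ (ren ρ' t) ≡ ren (ρ ∘ ρ') t
ren-∘ ρ ρ' (var x)   = refl
ren-∘ ρ ρ' (app t u) = cong₂ app (ren-∘ ρ ρ' t) (ren-∘ ρ ρ' u)
ren-∘ ρ ρ' (lam t)   =
  cong lam (trans (ren-∘ (extR ρ) (extR ρ') t) (ren-cong (λ { zero → refl ; (suc x) → refl }) t))

ren-sub : ∀ {Γ Δ Ε A} (ρ : Ren Δ Ε) (σ : Sub Γ Δ) (t : Tm Γ A) → ren ρ (sub σ t) ≡ sub (ren ρ ∘ σ) t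
ren-sub ρ σ (var x)   = refl
ren-sub ρ σ (app t u) = cong₂ app (ren-sub ρ σ t) (ren-sub ρ σ u)
ren-sub ρ σ (lam t)   = cong lam (trans (ren-sub (extR ρ) (extS σ) t) (sub-cong ext-wk t))
  where
  ext-wk : (ren (extR ρ) ∘ extS σ) ≗ˢ extS (ren ρ ∘ σ)
  ext-wk zero    = refl
  ext-wk (suc x) = trans (ren-∘ (extR ρ) suc (σ x)) (sym (ren-∘ suc ρ (σ x)))

sub-ren : ∀ {Γ Δ Ε A} (σ : Sub Δ Ε) (ρ : Ren Γ Δ) (t : Tm Γ A) → sub σ (ren ρ t) ≡ sub (σ ∘ ρ) t
sub-ren σ ρ (var x)   = refl
sub-ren σ ρ (app t u) = cong₂ app (sub-ren σ ρ t) (sub-ren σ ρ u)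
sub-ren σ ρ (lam t)   =
  cong lam (trans (sub-ren (extS σ) (extR ρ) t) (sub-cong (λ { zero → refl ; (suc x) → refl }) t))

sub-var : ∀ {Γ A} (t : Tm Γ A) → sub var t ≡ t
sub-var (var x)   = refl
sub-var (app t u) = cong₂ app (sub-var t) (sub-var u)
sub-var (lam t)   = cong lam (trans (sub-cong (λ { zero → refl ; (suc x) → refl }) t) (sub-var t))

ren-as-sub : ∀ {Γ Δ A} (ρ : Ren Γ Δ) (t : Tm Γ A) → ren ρ t ≡ sub (var ∘ ρ) t
ren-as-sub ρ (var x)   = refl
ren-as-sub ρ (app t u) = cong₂ app (ren-as-sub ρ t) (ren-as-sub ρ u)
ren-as-sub ρ (lam t)   =
  cong lam (trans (ren-as-sub (extR ρ) t) (sub-cong (λ { zero → refl ; (suc x) → refl }) t))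

sub-extS-wk : ∀ {Γ Δ A B} (σ : Sub Γ Δ) (t : Tm Γ A) → sub (extS {B = B} σ) (wk t) ≡ wk (sub σ t)
sub-extS-wk σ t = trans (sub-ren (extS σ) suc t) (sym (ren-sub suc σ t))

sub-∘ : ∀ {Γ Δ Ε A} (σ : Sub Δ Ε) (σ' : Sub Γ Δ) (t : Tm Γ A) → sub σ (sub σ' t) ≡ sub (sub σ ∘ σ') t
sub-∘ σ σ' (var x)   = refl
sub-∘ σ σ' (app t u) = cong₂ app (sub-∘ σ σ' t) (sub-∘ σ σ' u)
sub-∘ σ σ' (lam t)   =
  cong lam (trans (sub-∘ (extS σ) (extS σ') t)
                  (sub-cong (λ { zero → refl ; (suc x) → sub-extS-wk σ (σ' x) }) t))

sub₀-wk : ∀ {Γ A B} (u : Tm Γ B) (t : Tm Γ A) → sub (sub₀ u) (wk t) ≡ t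
sub₀-wk u t = trans (sub-ren (sub₀ u) suc t) (sub-var t)

sub-[]₀ : ∀ {Γ Δ A B} (σ : Sub Γ Δ) (t : Tm (B ∷ Γ) A) (u : Tm Γ B) →
          sub σ (t [ u ]₀) ≡ (sub (extS σ) t) [ sub σ u ]₀
sub-[]₀ σ t u = begin
  sub σ (t [ u ]₀)                         ≡⟨ sub-∘ σ (sub₀ u) t ⟩
  sub (sub σ ∘ sub₀ u) t                   ≡⟨ sub-cong pointwise t ⟩
  sub (sub (sub₀ (sub σ u)) ∘ extS σ) t    ≡⟨ sub-∘ (sub₀ (sub σ u)) (extS σ) t ⟨
  (sub (extS σ) t) [ sub σ u ]₀            ∎
  where
  open ≡-Reasoning
  pointwise : (sub σ ∘ sub₀ u) ≗ˢ (sub (sub₀ (sub σ u)) ∘ extS σ)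
  pointwise zero    = refl
  pointwise (suc x) = sym (sub₀-wk (sub σ u) (σ x))

≡⇒≈ : ∀ {Γ A} {t u : Tm Γ A} → t ≡ u → t ≈ u
≡⇒≈ refl = ≈refl

sub-resp-≈ : ∀ {Γ Δ A} (σ : Sub Γ Δ) {t u : Tm Γ A} → t ≈ u → sub σ t ≈ sub σ u
sub-resp-≈ σ ≈refl          = ≈refl
sub-resp-≈ σ (≈sym p)       = ≈sym (sub-resp-≈ σ p)
sub-resp-≈ σ (≈trans p q)   = ≈trans (sub-resp-≈ σ p) (sub-resp-≈ σ q)
sub-resp-≈ σ (app-cong p q) = app-cong (sub-resp-≈ σ p) (sub-resp-≈ σ q)
sub-resp-≈ σ (lam-cong p)   = lam-cong (sub-resp-≈ (extS σ) p)
sub-resp-≈ σ (β t u)        = ≈trans (β _ _) (≡⇒≈ (sym (sub-[]₀ σ t u)))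
sub-resp-≈ σ (η t)          = ≈trans (lam-cong (app-cong (≡⇒≈ (sub-extS-wk σ t)) ≈refl)) (η _)

ren-resp-≈ : ∀ {Γ Δ A} (ρ : Ren Γ Δ) {t u : Tm Γ A} → t ≈ u → ren ρ t ≈ ren ρ u
ren-resp-≈ ρ {t} {u} p =
  subst₂ _≈_ (sym (ren-as-sub ρ t)) (sym (ren-as-sub ρ u)) (sub-resp-≈ (var ∘ ρ) p)

≈-setoid : Ctx → Ty → Setoid _ _
≈-setoid Γ A = record
  { Carrier       = Tm Γ A
  ; _≈_           = _≈_
  ; isEquivalence = record { refl = ≈refl ; sym = ≈sym ; trans = ≈trans }
  }

-- Normalisation by evaluation

mutual
  data Ne (Γ : Ctx) : Ty → Set where
    nvar : ∀ {A} → Γ ∋ A → Ne Γ A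
    napp : ∀ {A As} → Ne Γ [ A ∷ As ] → Nf Γ A → Ne Γ [ As ]

  data Nf (Γ : Ctx) : Ty → Set where
    nne  : Ne Γ o → Nf Γ o
    nlam : ∀ {A As} → Nf (A ∷ Γ) [ As ] → Nf Γ [ A ∷ As ]

mutual
  renNe : ∀ {Γ Δ A} → Ren Γ Δ → Ne Γ A → Ne Δ A
  renNe ρ (nvar x)   = nvar (ρ x)
  renNe ρ (napp n m) = napp (renNe ρ n) (renNf ρ m)

  renNf : ∀ {Γ Δ A} → Ren Γ Δ → Nf Γ A → Nf Δ A
  renNf ρ (nne n)  = nne (renNe ρ n)
  renNf ρ (nlam m) = nlam (renNf (extR ρ) m)

mutual
  renNe-cong : ∀ {Γ Δ A} {ρ ρ' : Ren Γ Δ} → ρ ≗ʳ ρ' → (n : Ne Γ A) → renNe ρ n ≡ renNe ρ' n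
  renNe-cong p (nvar x)   = cong nvar (p x)
  renNe-cong p (napp n m) = cong₂ napp (renNe-cong p n) (renNf-cong p m)

  renNf-cong : ∀ {Γ Δ A} {ρ ρ' : Ren Γ Δ} → ρ ≗ʳ ρ' → (n : Nf Γ A) → renNf ρ n ≡ renNf ρ' n
  renNf-cong p (nne n)  = cong nne (renNe-cong p n)
  renNf-cong p (nlam m) = cong nlam (renNf-cong (extR-cong p) m)

mutual
  renNe-id : ∀ {Γ A} (n : Ne Γ A) → renNe id n ≡ n
  renNe-id (nvar x)   = refl
  renNe-id (napp n m) = cong₂ napp (renNe-id n) (renNf-id m)

  renNf-id : ∀ {Γ A} (n : Nf Γ A) → renNf id n ≡ n
  renNf-id (nne n)  = cong nne (renNe-id n)
  renNf-id (nlam m) = cong nlam (trans (renNf-cong (λ { zero → refl ; (suc x) → refl }) m) (renNf-id m))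

mutual
  renNe-∘ : ∀ {Γ Δ Ε A} (ρ : Ren Δ Ε) (ρ' : Ren Γ Δ) (n : Ne Γ A) → renNe ρ (renNe ρ' n) ≡ renNe (ρ ∘ ρ') n
  renNe-∘ ρ ρ' (nvar x)   = refl
  renNe-∘ ρ ρ' (napp n m) = cong₂ napp (renNe-∘ ρ ρ' n) (renNf-∘ ρ ρ' m)

  renNf-∘ : ∀ {Γ Δ Ε A} (ρ : Ren Δ Ε) (ρ' : Ren Γ Δ) (n : Nf Γ A) → renNf ρ (renNf ρ' n) ≡ renNf (ρ ∘ ρ') n
  renNf-∘ ρ ρ' (nne n)  = cong nne (renNe-∘ ρ ρ' n)
  renNf-∘ ρ ρ' (nlam m) =
    cong nlam (trans (renNf-∘ (extR ρ) (extR ρ') m) (renNf-cong (λ { zero → refl ; (suc x) → refl }) m))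

mutual
  ⌜_⌝ne : ∀ {Γ A} → Ne Γ A → Tm Γ A
  ⌜ nvar x ⌝ne   = var x
  ⌜ napp n m ⌝ne = app ⌜ n ⌝ne ⌜ m ⌝nf

  ⌜_⌝nf : ∀ {Γ A} → Nf Γ A → Tm Γ A
  ⌜ nne n ⌝nf  = ⌜ n ⌝ne
  ⌜ nlam m ⌝nf = lam ⌜ m ⌝nf

ren-⌜⌝ne : ∀ {Γ Δ A} (ρ : Ren Γ Δ) (n : Ne Γ A) → ren ρ ⌜ n ⌝ne ≡ ⌜ renNe ρ n ⌝ne
ren-⌜⌝nf : ∀ {Γ Δ A} (ρ : Ren Γ Δ) (n : Nf Γ A) → ren ρ ⌜ n ⌝nf ≡ ⌜ renNf ρ n ⌝nf
ren-⌜⌝ne ρ (nvar x)   = refl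
ren-⌜⌝ne ρ (napp n m) = cong₂ app (ren-⌜⌝ne ρ n) (ren-⌜⌝nf ρ m)
ren-⌜⌝nf ρ (nne n)    = ren-⌜⌝ne ρ n
ren-⌜⌝nf ρ (nlam m)   = cong lam (ren-⌜⌝nf (extR ρ) m)

mutual
  Sem : Ty → Ctx → Set
  Sem [ As ] Γ = SemL As Γ

  SemL : List Ty → Ctx → Set
  SemL []       Γ = Ne Γ o
  SemL (A ∷ As) Γ = ∀ {Δ} → Ren Γ Δ → Sem A Δ → SemL As Δ

renSemL : ∀ As {Γ Δ} → Ren Γ Δ → SemL As Γ → SemL As Δ
renSemL []       ρ n = renNe ρ n
renSemL (A ∷ As) ρ f = λ ρ' v → f (ρ' ∘ ρ) v

renSem : ∀ A {Γ Δ} → Ren Γ Δ → Sem A Γ → Sem A Δ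
renSem [ As ] = renSemL As

mutual
  reflectL : ∀ As {Γ} → Ne Γ [ As ] → SemL As Γ
  reflectL []       n = n
  reflectL (A ∷ As) n = λ ρ v → reflectL As (napp (renNe ρ n) (reify A v))

  reifyL : ∀ As {Γ} → SemL As Γ → Nf Γ [ As ]
  reifyL []       n = nne n
  reifyL (A ∷ As) f = nlam (reifyL As (f suc (reflect A (nvar zero))))

  reflect : ∀ A {Γ} → Ne Γ A → Sem A Γ
  reflect [ As ] = reflectL As

  reify : ∀ A {Γ} → Sem A Γ → Nf Γ A
  reify [ As ] = reifyL As

Env : Ctx → Ctx → Set
Env Γ Δ = ∀ {A} → Γ ∋ A → Sem A Δ

ext : ∀ {Γ Δ A} → Env Γ Δ → Sem A Δ → Env (A ∷ Γ) Δ
ext γ v zero    = v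
ext γ v (suc x) = γ x

renEnv : ∀ {Γ Δ Ε} → Ren Δ Ε → Env Γ Δ → Env Γ Ε
renEnv ρ γ {A} x = renSem A ρ (γ x)

eval : ∀ {Γ Δ A} → Tm Γ A → Env Γ Δ → Sem A Δ
eval (var x)   γ = γ x
eval (app t u) γ = eval t γ id (eval u γ)
eval (lam t)   γ = λ ρ v → eval t (ext (renEnv ρ γ) v)

idEnv : ∀ {Γ} → Env Γ Γ
idEnv {A = A} x = reflect A (nvar x)

nf : ∀ {Γ A} → Tm Γ A → Nf Γ A
nf {A = A} t = reify A (eval t idEnv)

-- Completeness

-- A Kripke partial equivalence on values; a function value is related to itself only if it
-- commutes with renaming (NatL), which is what makes eval and reify respect it.
mutual
  EqL : ∀ As {Γ} → SemL As Γ → SemL As Γ → Set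
  EqL []       a b = a ≡ b
  EqL (A ∷ As) {Γ} f g =
    (∀ {Δ} (ρ : Ren Γ Δ) {a b} → Eq A a b → EqL As (f ρ a) (g ρ b)) × NatL A As f × NatL A As g

  NatL : ∀ A As {Γ} → SemL (A ∷ As) Γ → Set
  NatL A As {Γ} f = ∀ {Δ Ε} (ρ : Ren Γ Δ) (ρ' : Ren Δ Ε) {a} → Eq A a a →
    EqL As (renSemL As ρ' (f ρ a)) (f (ρ' ∘ ρ) (renSem A ρ' a))

  Eq : ∀ A {Γ} → Sem A Γ → Sem A Γ → Set
  Eq [ As ] = EqL As

mutual
  EqL-sym : ∀ As {Γ} {a b : SemL As Γ} → EqL As a b → EqL As b a
  EqL-sym []       p              = sym p
  EqL-sym (A ∷ As) (h , natf , natg) = (λ ρ q → EqL-sym As (h ρ (Eq-sym A q))) , natg , natf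

  Eq-sym : ∀ A {Γ} {a b : Sem A Γ} → Eq A a b → Eq A b a
  Eq-sym [ As ] = EqL-sym As

mutual
  EqL-trans : ∀ As {Γ} {a b c : SemL As Γ} → EqL As a b → EqL As b c → EqL As a c
  EqL-trans []       p q = trans p q
  EqL-trans (A ∷ As) (h , natf , _) (h' , _ , nath) =
    (λ ρ q → EqL-trans As (h ρ q) (h' ρ (Eq-trans A (Eq-sym A q) q))) , natf , nath

  Eq-trans : ∀ A {Γ} {a b c : Sem A Γ} → Eq A a b → Eq A b c → Eq A a c
  Eq-trans [ As ] = EqL-trans As

Eq-reflˡ : ∀ A {Γ} {a b : Sem A Γ} → Eq A a b → Eq A a a
Eq-reflˡ A p = Eq-trans A p (Eq-sym A p)

Eq-reflʳ : ∀ A {Γ} {a b : Sem A Γ} → Eq A a b → Eq A b b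
Eq-reflʳ A p = Eq-trans A (Eq-sym A p) p

Eq-ren : ∀ A {Γ Δ} (ρ : Ren Γ Δ) {a b : Sem A Γ} → Eq A a b → Eq A (renSem A ρ a) (renSem A ρ b)
Eq-ren [ [] ]     ρ p                 = cong (renNe ρ) p
Eq-ren [ A ∷ As ] ρ (h , natf , natg) =
  (λ ρ' q → h (ρ' ∘ ρ) q) , (λ ρ₁ ρ₂ q → natf (ρ₁ ∘ ρ) ρ₂ q) , (λ ρ₁ ρ₂ q → natg (ρ₁ ∘ ρ) ρ₂ q)

renSem-id : ∀ A {Γ} {a : Sem A Γ} → Eq A a a → Eq A (renSem A id a) a
renSem-id [ [] ]     {a = a} p = renNe-id a
renSem-id [ A ∷ As ] p         = p

renSem-∘ : ∀ A {Γ Δ Ε} (ρ' : Ren Δ Ε) (ρ : Ren Γ Δ) {a : Sem A Γ} → Eq A a a →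
           Eq A (renSem A ρ' (renSem A ρ a)) (renSem A (ρ' ∘ ρ) a)
renSem-∘ [ [] ]     ρ' ρ {a} p = renNe-∘ ρ' ρ a
renSem-∘ [ A ∷ As ] ρ' ρ p     = Eq-ren [ A ∷ As ] (ρ' ∘ ρ) p

mutual
  reflectL-Eq : ∀ As {Γ} (n : Ne Γ [ As ]) → EqL As (reflectL As n) (reflectL As n)
  reflectL-Eq []       n = refl
  reflectL-Eq (A ∷ As) n =
    (λ ρ q → reflectL-≡ As (cong (napp (renNe ρ n)) (reify-Eq A q))) , natural , natural
    where
    natural : NatL A As (reflectL (A ∷ As) n)
    natural ρ ρ' {a} q = EqL-trans As (reflectL-ren As ρ' (napp (renNe ρ n) (reify A a)))
      (reflectL-≡ As (cong₂ napp (renNe-∘ ρ' ρ n) (sym (reify-ren A ρ' q))))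

  reflectL-≡ : ∀ As {Γ} {n n' : Ne Γ [ As ]} → n ≡ n' → EqL As (reflectL As n) (reflectL As n')
  reflectL-≡ As {n = n} refl = reflectL-Eq As n

  reflectL-ren : ∀ As {Γ Δ} (ρ : Ren Γ Δ) (n : Ne Γ [ As ]) →
                 EqL As (renSemL As ρ (reflectL As n)) (reflectL As (renNe ρ n))
  reflectL-ren []       ρ n = refl
  reflectL-ren (A ∷ As) ρ n =
    (λ ρ' q → reflectL-≡ As (cong₂ napp (sym (renNe-∘ ρ' ρ n)) (reify-Eq A q))) ,
    proj₁ (proj₂ (Eq-ren [ A ∷ As ] ρ (reflectL-Eq (A ∷ As) n))) ,
    proj₁ (proj₂ (reflectL-Eq (A ∷ As) (renNe ρ n)))

  reifyL-Eq : ∀ As {Γ} {a b : SemL As Γ} → EqL As a b → reifyL As a ≡ reifyL As b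
  reifyL-Eq []             p           = cong nne p
  reifyL-Eq ([ Bs ] ∷ As) (h , _ , _) = cong nlam (reifyL-Eq As (h suc (reflectL-Eq Bs (nvar zero))))

  reify-Eq : ∀ A {Γ} {a b : Sem A Γ} → Eq A a b → reify A a ≡ reify A b
  reify-Eq [ As ] = reifyL-Eq As

  reifyL-ren : ∀ As {Γ Δ} (ρ : Ren Γ Δ) {a : SemL As Γ} → EqL As a a →
               reifyL As (renSemL As ρ a) ≡ renNf ρ (reifyL As a)
  reifyL-ren []             ρ p              = refl
  reifyL-ren ([ Bs ] ∷ As) ρ (h , natf , _) = cong nlam (sym (trans
    (sym (reifyL-ren As (extR ρ) (h suc fresh)))
    (trans (reifyL-Eq As (natf suc (extR ρ) fresh))
           (reifyL-Eq As (h (suc ∘ ρ) (reflectL-ren Bs (extR ρ) (nvar zero)))))))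
    where
    fresh : ∀ {Δ} → EqL Bs {[ Bs ] ∷ Δ} (reflectL Bs (nvar zero)) (reflectL Bs (nvar zero))
    fresh = reflectL-Eq Bs (nvar zero)

  reify-ren : ∀ A {Γ Δ} (ρ : Ren Γ Δ) {a : Sem A Γ} → Eq A a a → reify A (renSem A ρ a) ≡ renNf ρ (reify A a)
  reify-ren [ As ] = reifyL-ren As

EqEnv : ∀ {Γ Δ} → Env Γ Δ → Env Γ Δ → Set
EqEnv {Γ} γ γ' = ∀ {A} (x : Γ ∋ A) → Eq A (γ x) (γ' x)

EqEnv-reflˡ : ∀ {Γ Δ} {γ γ' : Env Γ Δ} → EqEnv γ γ' → EqEnv γ γ
EqEnv-reflˡ p {A} x = Eq-reflˡ A (p x)

EqEnv-reflʳ : ∀ {Γ Δ} {γ γ' : Env Γ Δ} → EqEnv γ γ' → EqEnv γ' γ'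
EqEnv-reflʳ p {A} x = Eq-reflʳ A (p x)

EqEnv-sym : ∀ {Γ Δ} {γ γ' : Env Γ Δ} → EqEnv γ γ' → EqEnv γ' γ
EqEnv-sym p {A} x = Eq-sym A (p x)

EqEnv-ext : ∀ {Γ Δ A} {γ γ' : Env Γ Δ} {a b : Sem A Δ} → EqEnv γ γ' → Eq A a b →
            EqEnv (ext {A = A} γ a) (ext {A = A} γ' b)
EqEnv-ext p q zero    = q
EqEnv-ext p q (suc x) = p x

EqEnv-ren : ∀ {Γ Δ Ε} (ρ : Ren Δ Ε) {γ γ' : Env Γ Δ} → EqEnv γ γ' → EqEnv (renEnv ρ γ) (renEnv ρ γ')
EqEnv-ren ρ p {A} x = Eq-ren A ρ (p x)

idEnv-Eq : ∀ {Γ} → EqEnv (idEnv {Γ}) idEnv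
idEnv-Eq {A = [ As ]} x = reflectL-Eq As (nvar x)

mutual
  eval-Eq : ∀ {Γ Δ A} (t : Tm Γ A) {γ γ' : Env Γ Δ} → EqEnv γ γ' → Eq A (eval t γ) (eval t γ')
  eval-Eq (var x)   p = p x
  eval-Eq (app t u) p = proj₁ (eval-Eq t p) id (eval-Eq u p)
  eval-Eq (lam t)   p = (λ ρ q → eval-Eq t (EqEnv-ext (EqEnv-ren ρ p) q)) ,
    eval-lam-natural t (EqEnv-reflˡ p) , eval-lam-natural t (EqEnv-reflʳ p)

  eval-lam-natural : ∀ {Γ Δ A As} (t : Tm (A ∷ Γ) [ As ]) {γ : Env Γ Δ} → EqEnv γ γ →
                     NatL A As (eval (lam t) γ)
  eval-lam-natural {A = A} {As} t {γ} p ρ ρ' {a} q =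
    EqL-trans As (eval-ren-env t ρ' (EqEnv-ext (EqEnv-ren ρ p) q)) (eval-Eq t env)
    where
    env : EqEnv (renEnv ρ' (ext {A = A} (renEnv ρ γ) a)) (ext {A = A} (renEnv (ρ' ∘ ρ) γ) (renSem A ρ' a))
    env zero        = Eq-ren A ρ' q
    env {B} (suc x) = renSem-∘ B ρ' ρ (p x)

  eval-ren-env : ∀ {Γ Δ Ε A} (t : Tm Γ A) (ρ' : Ren Δ Ε) {γ : Env Γ Δ} → EqEnv γ γ →
                 Eq A (renSem A ρ' (eval t γ)) (eval t (renEnv ρ' γ))
  eval-ren-env {A = A} (var x) ρ' p = Eq-ren A ρ' (p x)
  eval-ren-env {A = [ As ]} (app t u) ρ' p =
    EqL-trans As (proj₁ (proj₂ (eval-Eq t p)) id ρ' (eval-Eq u p))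
                 (proj₁ (eval-ren-env t ρ' p) id (eval-ren-env u ρ' p))
  eval-ren-env {A = [ A ∷ As ]} (lam t) ρ' {γ} p =
    (λ ρ q → eval-Eq t (EqEnv-ext (env ρ) q)) ,
    proj₁ (proj₂ (Eq-ren [ A ∷ As ] ρ' (eval-Eq (lam t) p))) ,
    eval-lam-natural t (EqEnv-ren ρ' p)
    where
    env : ∀ {Ε'} (ρ : Ren _ Ε') → EqEnv (renEnv (ρ ∘ ρ') γ) (renEnv ρ (renEnv ρ' γ))
    env ρ {B} x = Eq-sym B (renSem-∘ B ρ ρ' (p x))

eval-ren : ∀ {Γ Γ' Δ A} (t : Tm Γ A) (ρ : Ren Γ Γ') {γ : Env Γ' Δ} {δ : Env Γ Δ} →
           EqEnv γ γ → (∀ {B} (x : Γ ∋ B) → Eq B (γ (ρ x)) (δ x)) → Eq A (eval (ren ρ t) γ) (eval t δ)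
eval-ren (var x)   ρ pγ p = p x
eval-ren (app t u) ρ pγ p = proj₁ (eval-ren t ρ pγ p) id (eval-ren u ρ pγ p)
eval-ren {A = [ A ∷ As ]} (lam t) ρ {γ} {δ} pγ p =
  (λ ρ' q → eval-ren t (extR ρ) (EqEnv-ext (EqEnv-ren ρ' pγ) (Eq-reflˡ A q)) (related ρ' q)) ,
  eval-lam-natural (ren (extR ρ) t) pγ , eval-lam-natural t (λ {B} x → Eq-reflʳ B (p x))
  where
  related : ∀ {Ε} (ρ' : Ren _ Ε) {a b} → Eq A a b → ∀ {B} (x : (A ∷ _) ∋ B) →
            Eq B (ext {A = A} (renEnv ρ' γ) a (extR ρ x)) (ext {A = A} (renEnv ρ' δ) b x)
  related ρ' q zero        = q
  related ρ' q {B} (suc x) = Eq-ren B ρ' (p x)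

eval-sub : ∀ {Γ Γ' Δ A} (t : Tm Γ A) (σ : Sub Γ Γ') {γ : Env Γ' Δ} {δ : Env Γ Δ} →
           EqEnv γ γ → (∀ {B} (x : Γ ∋ B) → Eq B (eval (σ x) γ) (δ x)) → Eq A (eval (sub σ t) γ) (eval t δ)
eval-sub (var x)   σ pγ p = p x
eval-sub (app t u) σ pγ p = proj₁ (eval-sub t σ pγ p) id (eval-sub u σ pγ p)
eval-sub {A = [ A ∷ As ]} (lam t) σ {γ} {δ} pγ p =
  (λ ρ q → eval-sub t (extS σ) (EqEnv-ext (EqEnv-ren ρ pγ) (Eq-reflˡ A q)) (related ρ q)) ,
  eval-lam-natural (sub (extS σ) t) pγ , eval-lam-natural t (λ {B} x → Eq-reflʳ B (p x))
  where
  related : ∀ {Ε} (ρ : Ren _ Ε) {a b} → Eq A a b → ∀ {B} (x : (A ∷ _) ∋ B) →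
            Eq B (eval (extS σ x) (ext {A = A} (renEnv ρ γ) a)) (ext {A = A} (renEnv ρ δ) b x)
  related ρ q zero        = q
  related ρ q {B} (suc x) =
    Eq-trans B (eval-ren (σ x) suc (EqEnv-ext (EqEnv-ren ρ pγ) (Eq-reflˡ A q)) (λ {C} y → Eq-ren C ρ (pγ y)))
      (Eq-trans B (Eq-sym B (eval-ren-env (σ x) ρ pγ)) (Eq-ren B ρ (p x)))

eval-≈ : ∀ {Γ Δ A} {t u : Tm Γ A} → t ≈ u → {γ γ' : Env Γ Δ} → EqEnv γ γ' → Eq A (eval t γ) (eval u γ')
eval-≈ {t = t} ≈refl p         = eval-Eq t p
eval-≈ {A = A} (≈sym q) p      = Eq-sym A (eval-≈ q (EqEnv-sym p))
eval-≈ {A = A} (≈trans q r) p  = Eq-trans A (eval-≈ q (EqEnv-reflˡ p)) (eval-≈ r p)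
eval-≈ (app-cong q r) p        = proj₁ (eval-≈ q p) id (eval-≈ r p)
eval-≈ (lam-cong {t = t} {t'} q) p =
  (λ ρ r → eval-≈ q (EqEnv-ext (EqEnv-ren ρ p) r)) ,
  eval-lam-natural t (EqEnv-reflˡ p) , eval-lam-natural t' (EqEnv-reflʳ p)
eval-≈ {A = A} (β {A = B} t u) {γ} {γ'} p = Eq-sym A (eval-sub t (sub₀ u) (EqEnv-reflʳ p) related)
  where
  related : ∀ {C} (x : (B ∷ _) ∋ C) → Eq C (eval (sub₀ u x) γ') (ext {A = B} (renEnv id γ) (eval u γ) x)
  related zero        = eval-Eq u (EqEnv-sym p)
  related {C} (suc x) = Eq-sym C (Eq-trans C (renSem-id C (Eq-reflˡ C (p x))) (p x))
eval-≈ (η {A = A} {As} t) {γ} {γ'} p =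
  (λ ρ q → proj₁ (wk-eval ρ q) id q) ,
  eval-lam-natural (app (wk t) (var zero)) (EqEnv-reflˡ p) ,
  proj₁ (proj₂ (eval-Eq t (EqEnv-reflʳ p)))
  where
  wk-eval : ∀ {Ε} (ρ : Ren _ Ε) {a b} → Eq A a b →
            Eq [ A ∷ As ] (eval (wk t) (ext {A = A} (renEnv ρ γ) a)) (renSem [ A ∷ As ] ρ (eval t γ'))
  wk-eval ρ q = Eq-trans [ A ∷ As ]
    (eval-ren t suc (EqEnv-ext (EqEnv-ren ρ (EqEnv-reflˡ p)) (Eq-reflˡ A q))
                    (λ {C} y → Eq-ren C ρ (EqEnv-reflˡ p y)))
    (Eq-trans [ A ∷ As ] (Eq-sym [ A ∷ As ] (eval-ren-env t ρ (EqEnv-reflˡ p)))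
                         (Eq-ren [ A ∷ As ] ρ (eval-Eq t p)))

nf-complete : ∀ {Γ A} {t u : Tm Γ A} → t ≈ u → nf t ≡ nf u
nf-complete {A = A} p = reify-Eq A (eval-≈ p idEnv-Eq)

nf-ren : ∀ {Γ Δ A} (ρ : Ren Γ Δ) (t : Tm Γ A) → nf (ren ρ t) ≡ renNf ρ (nf t)
nf-ren {A = A} ρ t =
  trans (reify-Eq A (Eq-trans A (eval-ren t ρ idEnv-Eq related) (Eq-sym A (eval-ren-env t ρ idEnv-Eq))))
        (reify-ren A ρ (eval-Eq t idEnv-Eq))
  where
  related : ∀ {B} (x : _ ∋ B) → Eq B (idEnv (ρ x)) (renEnv ρ idEnv x)
  related {[ Bs ]} x = EqL-sym Bs (reflectL-ren Bs ρ (nvar x))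

-- Soundness

mutual
  RL : ∀ As {Γ} → Tm Γ [ As ] → SemL As Γ → Set
  RL []       t n = t ≈ ⌜ n ⌝ne
  RL (A ∷ As) {Γ} t f = ∀ {Δ} (ρ : Ren Γ Δ) {u a} → R A u a → RL As (app (ren ρ t) u) (f ρ a)

  R : ∀ A {Γ} → Tm Γ A → Sem A Γ → Set
  R [ As ] = RL As

R-≈ : ∀ A {Γ} {t t' : Tm Γ A} {a} → t ≈ t' → R A t a → R A t' a
R-≈ [ [] ]     p q = ≈trans (≈sym p) q
R-≈ [ B ∷ As ] p h = λ ρ r → R-≈ [ As ] (app-cong (ren-resp-≈ ρ p) ≈refl) (h ρ r)

R-ren : ∀ A {Γ Δ} (ρ : Ren Γ Δ) {t : Tm Γ A} {a} → R A t a → R A (ren ρ t) (renSem A ρ a)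
R-ren [ [] ]     ρ {t} {n} p = ≈trans (ren-resp-≈ ρ p) (≡⇒≈ (ren-⌜⌝ne ρ n))
R-ren [ B ∷ As ] ρ {t} h     =
  λ ρ' {u} r → R-≈ [ As ] (≡⇒≈ (cong (λ s → app s u) (sym (ren-∘ ρ' ρ t)))) (h (ρ' ∘ ρ) r)

mutual
  reflect-R : ∀ As {Γ} {t : Tm Γ [ As ]} {n} → t ≈ ⌜ n ⌝ne → RL As t (reflectL As n)
  reflect-R []       p         = p
  reflect-R (A ∷ As) {n = n} p =
    λ ρ r → reflect-R As (app-cong (≈trans (ren-resp-≈ ρ p) (≡⇒≈ (ren-⌜⌝ne ρ n))) (reify-R A r))

  reify-R : ∀ A {Γ} {t : Tm Γ A} {a} → R A t a → t ≈ ⌜ reify A a ⌝nf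
  reify-R [ [] ]           p         = p
  reify-R [ [ Bs ] ∷ As ] {t = t} h =
    ≈trans (≈sym (η t)) (lam-cong (reify-R [ As ] (h suc (reflect-R Bs ≈refl))))

sub-eval-R : ∀ {Γ Δ A} (t : Tm Γ A) {σ : Sub Γ Δ} {γ : Env Γ Δ} → (∀ {B} (x : Γ ∋ B) → R B (σ x) (γ x)) →
             R A (sub σ t) (eval t γ)
sub-eval-R (var x) p = p x
sub-eval-R {A = [ As ]} (app t u) {σ} p =
  R-≈ [ As ] (app-cong (≡⇒≈ (ren-id (sub σ t))) ≈refl) (sub-eval-R t p id (sub-eval-R u p))
sub-eval-R {A = [ A ∷ As ]} (lam t) {σ} {γ} p ρ {u} {a} r =
  R-≈ [ As ] (≈sym (≈trans (β _ u) (≡⇒≈ unfold))) (sub-eval-R t {σ'} {ext {A = A} (renEnv ρ γ) a} p')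
  where
  σ' : Sub (A ∷ _) _
  σ' zero    = u
  σ' (suc x) = ren ρ (σ x)
  p' : ∀ {B} (x : (A ∷ _) ∋ B) → R B (σ' x) (ext {A = A} (renEnv ρ γ) a x)
  p' zero        = r
  p' {B} (suc x) = R-ren B ρ (p x)
  pointwise : (sub (sub₀ u) ∘ (ren (extR ρ) ∘ extS σ)) ≗ˢ σ'
  pointwise zero    = refl
  pointwise (suc x) = trans (cong (sub (sub₀ u)) (ren-∘ (extR ρ) suc (σ x)))
                            (trans (sub-ren (sub₀ u) (extR ρ ∘ suc) (σ x)) (sym (ren-as-sub ρ (σ x))))
  unfold : (ren (extR ρ) (sub (extS σ) t)) [ u ]₀ ≡ sub σ' t
  unfold = trans (cong (sub (sub₀ u)) (ren-sub (extR ρ) (extS σ) t))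
                 (trans (sub-∘ (sub₀ u) (ren (extR ρ) ∘ extS σ) t) (sub-cong pointwise t))

nf-sound : ∀ {Γ A} (t : Tm Γ A) → t ≈ ⌜ nf t ⌝nf
nf-sound {A = A} t = ≈trans (≡⇒≈ (sym (sub-var t))) (reify-R A (sub-eval-R t {var} {idEnv} var-R))
  where
  var-R : ∀ {B} (x : _ ∋ B) → R B (var x) (idEnv x)
  var-R {[ Bs ]} x = reflect-R Bs ≈refl

nf-≡⇒≈ : ∀ {Γ A} {t u : Tm Γ A} → nf t ≡ nf u → t ≈ u
nf-≡⇒≈ {t = t} {u} p = ≈trans (nf-sound t) (≈trans (≡⇒≈ (cong ⌜_⌝nf p)) (≈sym (nf-sound u)))

-- Injectivity of heads, arguments, abstraction and renaming

nfAll : ∀ {Γ As} → All (Tm Γ) As → All (Nf Γ) As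
nfAll []       = []
nfAll (m ∷ ms) = nf m ∷ nfAll ms

nspine : ∀ {Γ As} → Ne Γ [ As ] → All (Nf Γ) As → Ne Γ o
nspine n []       = n
nspine n (m ∷ ms) = nspine (napp n m) ms

eval-apps : ∀ {Γ As} (t : Tm Γ [ As ]) (n : Ne Γ [ As ]) (M : All (Tm Γ) As) →
            eval t idEnv ≡ reflectL As n → eval (apps t M) idEnv ≡ nspine n (nfAll M)
eval-apps t n []       p = p
eval-apps {As = B ∷ Bs} t n (m ∷ ms) p = eval-apps (app t m) (napp n (nf m)) ms
  (trans (cong (λ f → f id (eval m idEnv)) p) (cong (λ n' → reflectL Bs (napp n' (nf m))) (renNe-id n)))

nf-apps-var : ∀ {Γ As} (x : Γ ∋ [ As ]) (M : All (Tm Γ) As) → nf (apps (var x) M) ≡ nne (nspine (nvar x) (nfAll M))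
nf-apps-var x M = cong nne (eval-apps (var x) (nvar x) M refl)

Spine : Ctx → Set
Spine Γ = Σ (List Ty) λ As → (Γ ∋ [ As ]) × All (Nf Γ) As

unspine : ∀ {Γ As} → Ne Γ [ As ] → All (Nf Γ) As → Spine Γ
unspine (nvar x)   acc = _ , x , acc
unspine (napp n m) acc = unspine n (m ∷ acc)

unspine-nspine : ∀ {Γ As} (n : Ne Γ [ As ]) (ms : All (Nf Γ) As) → unspine (nspine n ms) [] ≡ unspine n ms
unspine-nspine n []       = refl
unspine-nspine n (m ∷ ms) = unspine-nspine (napp n m) ms

nfAll-≡⇒ArgsEq : ∀ {Γ As} (M N : All (Tm Γ) As) → nfAll M ≡ nfAll N → ArgsEq M N
nfAll-≡⇒ArgsEq []       []       p = []
nfAll-≡⇒ArgsEq (m ∷ ms) (n ∷ ns) p = nf-≡⇒≈ (cong head p) ∷ nfAll-≡⇒ArgsEq ms ns (cong tail p)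

nne-injective : ∀ {Γ} {n n' : Ne Γ o} → nne n ≡ nne n' → n ≡ n'
nne-injective refl = refl

spine-≡⇒SameHeadArgs : ∀ {Γ As Bs} (x : Γ ∋ [ As ]) (y : Γ ∋ [ Bs ]) (M : All (Tm Γ) As) (N : All (Tm Γ) Bs)
  {P : All (Nf Γ) As} {Q : All (Nf Γ) Bs} → P ≡ nfAll M → Q ≡ nfAll N →
  _≡_ {A = Spine Γ} (As , x , P) (Bs , y , Q) → SameHeadArgs x M y N
spine-≡⇒SameHeadArgs x .x M N p q refl = same x (nfAll-≡⇒ArgsEq M N (trans (sym p) q))

apps-var-injective : ∀ {Γ A B} (x : Γ ∋ A) (y : Γ ∋ B) (M : Args Γ A) (N : Args Γ B) →
                     apps (var x) M ≈ apps (var y) N → SameHeadArgs x M y N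
apps-var-injective {A = [ As ]} {[ Bs ]} x y M N p = spine-≡⇒SameHeadArgs x y M N refl refl (begin
  unspine (nvar x) (nfAll M)             ≡⟨ unspine-nspine (nvar x) (nfAll M) ⟨
  unspine (nspine (nvar x) (nfAll M)) [] ≡⟨ cong (λ n → unspine n []) same-spine ⟩
  unspine (nspine (nvar y) (nfAll N)) [] ≡⟨ unspine-nspine (nvar y) (nfAll N) ⟩
  unspine (nvar y) (nfAll N)             ∎)
  where
  open ≡-Reasoning
  same-spine : nspine (nvar x) (nfAll M) ≡ nspine (nvar y) (nfAll N)
  same-spine = nne-injective (trans (sym (nf-apps-var x M)) (trans (nf-complete p) (nf-apps-var y N)))

InjectiveRen : ∀ {Γ Δ} → Ren Γ Δ → Set
InjectiveRen ρ = ∀ {A} → Injective _≡_ _≡_ (ρ {A})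

suc-injective : ∀ {Γ A B} {x y : Γ ∋ A} → _≡_ {A = (B ∷ Γ) ∋ A} (suc x) (suc y) → x ≡ y
suc-injective refl = refl

extR-injective : ∀ {Γ Δ B} {ρ : Ren Γ Δ} → InjectiveRen ρ → InjectiveRen (extR {B = B} ρ)
extR-injective inj {x = zero}  {zero}  p  = refl
extR-injective inj {x = zero}  {suc y} ()
extR-injective inj {x = suc x} {zero}  ()
extR-injective inj {x = suc x} {suc y} p  = cong suc (inj (suc-injective p))

nvar-injective : ∀ {Γ A} {x y : Γ ∋ A} → nvar x ≡ nvar y → x ≡ y
nvar-injective refl = refl

nlam-injective : ∀ {Γ A As} {m m' : Nf (A ∷ Γ) [ As ]} → nlam m ≡ nlam m' → m ≡ m'
nlam-injective refl = refl

napp-injective : ∀ {Γ B B' As} {a : Ne Γ [ B ∷ As ]} {c : Ne Γ [ B' ∷ As ]} {b : Nf Γ B} {d : Nf Γ B'} →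
                 napp a b ≡ napp c d → Σ (B ≡ B') λ { refl → a ≡ c × b ≡ d }
napp-injective refl = refl , refl , refl

mutual
  renNe-injective : ∀ {Γ Δ A} {ρ : Ren Γ Δ} → InjectiveRen ρ → (n n' : Ne Γ A) → renNe ρ n ≡ renNe ρ n' → n ≡ n'
  renNe-injective inj (nvar x)   (nvar y)     p  = cong nvar (inj (nvar-injective p))
  renNe-injective inj (nvar x)   (napp n' m') ()
  renNe-injective inj (napp n m) (nvar y)     ()
  renNe-injective inj (napp n m) (napp n' m') p with napp-injective p
  ... | refl , q , r = cong₂ napp (renNe-injective inj n n' q) (renNf-injective inj m m' r)

  renNf-injective : ∀ {Γ Δ A} {ρ : Ren Γ Δ} → InjectiveRen ρ → (n n' : Nf Γ A) → renNf ρ n ≡ renNf ρ n' → n ≡ n'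
  renNf-injective inj (nne n)  (nne n')  p = cong nne (renNe-injective inj n n' (nne-injective p))
  renNf-injective inj (nlam m) (nlam m') p = cong nlam (renNf-injective (extR-injective inj) m m' (nlam-injective p))

ren-injective-≈ : ∀ {Γ Δ A} {ρ : Ren Γ Δ} → InjectiveRen ρ → {t u : Tm Γ A} → ren ρ t ≈ ren ρ u → t ≈ u
ren-injective-≈ {ρ = ρ} inj {t} {u} p =
  nf-≡⇒≈ (renNf-injective inj (nf t) (nf u) (trans (sym (nf-ren ρ t)) (trans (nf-complete p) (nf-ren ρ u))))

lam-injective-≈ : ∀ {Γ A As} {t u : Tm (A ∷ Γ) [ As ]} → lam t ≈ lam u → t ≈ u
lam-injective-≈ {t = t} {u} p = ≈trans (≈sym (β-wk-var t)) (≈trans (app-cong (ren-resp-≈ suc p) ≈refl) (β-wk-var u))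
  where
  β-wk-var : ∀ (s : Tm _ _) → app (ren suc (lam s)) (var zero) ≈ s
  β-wk-var s = ≈trans (β _ _) (≡⇒≈ (trans (sub-ren (sub₀ (var zero)) (extR suc) s)
    (trans (sub-cong (λ { zero → refl ; (suc x) → refl }) s) (sub-var s))))

data View++ (Ξ : Ctx) {Γ : Ctx} {A : Ty} : (Ξ ++ Γ) ∋ A → Set where
  is-inl : (x : Ξ ∋ A) → View++ Ξ (inl x)
  is-inr : (y : Γ ∋ A) → View++ Ξ (inr Ξ y)

view++ : ∀ Ξ {Γ A} (x : (Ξ ++ Γ) ∋ A) → View++ Ξ x
view++ []      x       = is-inr x
view++ (B ∷ Ξ) zero    = is-inl zero
view++ (B ∷ Ξ) (suc x) with view++ Ξ x
... | is-inl y = is-inl (suc y)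
... | is-inr y = is-inr y

inl-injective : ∀ Ξ {Γ A} {x y : Ξ ∋ A} → inl {Ξ} {Γ} x ≡ inl y → x ≡ y
inl-injective (B ∷ Ξ) {x = zero}  {zero}  p = refl
inl-injective (B ∷ Ξ) {x = suc x} {suc y} p = cong suc (inl-injective Ξ (suc-injective p))

inr-injective : ∀ Ξ {Γ A} {x y : Γ ∋ A} → inr Ξ x ≡ inr Ξ y → x ≡ y
inr-injective []      p = p
inr-injective (B ∷ Ξ) p = inr-injective Ξ (suc-injective p)

inl≢inr : ∀ Ξ {Γ A} {x : Ξ ∋ A} {y : Γ ∋ A} → inl x ≢ inr Ξ y
inl≢inr (B ∷ Ξ) {x = suc x} p = inl≢inr Ξ (suc-injective p)

split-inl : ∀ Ξ {Γ A} (x : Ξ ∋ A) → split Ξ {Γ} (inl x) ≡ inj₁ x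
split-inl (B ∷ Ξ) zero          = refl
split-inl (B ∷ Ξ) {Γ} (suc x) rewrite split-inl Ξ {Γ} x = refl

split-inr : ∀ Ξ {Γ A} (y : Γ ∋ A) → split Ξ (inr Ξ y) ≡ inj₂ y
split-inr []      y = refl
split-inr (B ∷ Ξ) y rewrite split-inr Ξ y = refl

lift-inl : ∀ Ξ {Γ Δ A} (ϱ : Sub Γ Δ) (x : Ξ ∋ A) → lift Ξ ϱ (inl x) ≡ var (inl x)
lift-inl Ξ {Γ} ϱ x rewrite split-inl Ξ {Γ} x = refl

lift-inr : ∀ Ξ {Γ Δ A} (ϱ : Sub Γ Δ) (y : Γ ∋ A) → lift Ξ ϱ (inr Ξ y) ≡ ren (inr Ξ) (ϱ y)
lift-inr Ξ ϱ y rewrite split-inr Ξ y = refl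

case++ : ∀ Ξ {Γ Δ} → Ren Ξ Δ → Ren Γ Δ → Ren (Ξ ++ Γ) Δ
case++ Ξ f g x = [ f , g ]′ (split Ξ x)

case++-inl : ∀ Ξ {Γ Δ} (f : Ren Ξ Δ) (g : Ren Γ Δ) {A} (x : Ξ ∋ A) → case++ Ξ f g (inl x) ≡ f x
case++-inl Ξ {Γ} f g x rewrite split-inl Ξ {Γ} x = refl

case++-inr : ∀ Ξ {Γ Δ} (f : Ren Ξ Δ) (g : Ren Γ Δ) {A} (y : Γ ∋ A) → case++ Ξ f g (inr Ξ y) ≡ g y
case++-inr Ξ f g y rewrite split-inr Ξ y = refl

case++-injective : ∀ Ξ {Γ Δ} {f : Ren Ξ Δ} {g : Ren Γ Δ} → InjectiveRen f → InjectiveRen g →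
                   (∀ {A} (x : Ξ ∋ A) (y : Γ ∋ A) → f x ≢ g y) → InjectiveRen (case++ Ξ f g)
case++-injective Ξ {f = f} {g} f-inj g-inj f≢g {x = x} {y} p with view++ Ξ x | view++ Ξ y
... | is-inl x' | is-inl y' = cong inl (f-inj (trans (sym (case++-inl Ξ f g x')) (trans p (case++-inl Ξ f g y'))))
... | is-inl x' | is-inr y' = ⊥-elim (f≢g x' y' (trans (sym (case++-inl Ξ f g x')) (trans p (case++-inr Ξ f g y'))))
... | is-inr x' | is-inl y' = ⊥-elim (f≢g y' x' (trans (sym (case++-inl Ξ f g y')) (trans (sym p) (case++-inr Ξ f g x'))))
... | is-inr x' | is-inr y' = cong (inr Ξ) (g-inj (trans (sym (case++-inr Ξ f g x')) (trans p (case++-inr Ξ f g y'))))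

-- Γ ◂ Δ is the context under λΔ, i.e. Γ extended by Δ on the inside.
_◂_ : Ctx → Ctx → Ctx
Γ ◂ []       = Γ
Γ ◂ (D ∷ Ds) = (D ∷ Γ) ◂ Ds

wk◂ : ∀ {Γ A} Δ → Γ ∋ A → (Γ ◂ Δ) ∋ A
wk◂ []       x = x
wk◂ (D ∷ Ds) x = wk◂ Ds (suc x)

new◂ : ∀ {Γ A} Δ → Δ ∋ A → (Γ ◂ Δ) ∋ A
new◂ (D ∷ Ds) zero    = wk◂ Ds zero
new◂ (D ∷ Ds) (suc y) = new◂ Ds y

wk◂-injective : ∀ {Γ} Δ → InjectiveRen (wk◂ {Γ} Δ)
wk◂-injective []       p = p
wk◂-injective (D ∷ Ds) p = suc-injective (wk◂-injective Ds p)

wk◂≢new◂ : ∀ {Γ A} Δ (x : Γ ∋ A) (y : Δ ∋ A) → wk◂ Δ x ≢ new◂ Δ y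
wk◂≢new◂ (D ∷ Ds) x zero    p with wk◂-injective Ds p
... | ()
wk◂≢new◂ (D ∷ Ds) x (suc y) p = wk◂≢new◂ Ds (suc x) y p

new◂-injective : ∀ {Γ} Δ → InjectiveRen (new◂ {Γ} Δ)
new◂-injective (D ∷ Ds) {x = zero}  {zero}  p = refl
new◂-injective (D ∷ Ds) {x = zero}  {suc y} p = ⊥-elim (wk◂≢new◂ Ds zero y p)
new◂-injective (D ∷ Ds) {x = suc x} {zero}  p = ⊥-elim (wk◂≢new◂ Ds zero x (sym p))
new◂-injective (D ∷ Ds) {x = suc x} {suc y} p = cong suc (new◂-injective Ds p)

subAll : ∀ {Γ Δ As} → Sub Γ Δ → All (Tm Γ) As → All (Tm Δ) As
subAll σ []       = []
subAll σ (m ∷ ms) = sub σ m ∷ subAll σ ms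

renAll : ∀ {Γ Δ As} → Ren Γ Δ → All (Tm Γ) As → All (Tm Δ) As
renAll ρ []       = []
renAll ρ (m ∷ ms) = ren ρ m ∷ renAll ρ ms

renAll-∘ : ∀ {Γ Δ Ε As} (ρ : Ren Δ Ε) (ρ' : Ren Γ Δ) (M : All (Tm Γ) As) →
           renAll ρ (renAll ρ' M) ≡ renAll (ρ ∘ ρ') M
renAll-∘ ρ ρ' []       = refl
renAll-∘ ρ ρ' (m ∷ ms) = cong₂ _∷_ (ren-∘ ρ ρ' m) (renAll-∘ ρ ρ' ms)

lookupAll : ∀ {Γ As A} → All (Tm Γ) As → As ∋ A → Tm Γ A
lookupAll (m ∷ ms) zero    = m
lookupAll (m ∷ ms) (suc y) = lookupAll ms y

varsAll : ∀ {Γ Δ} → Ren Δ Γ → All (Tm Γ) Δ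
varsAll {Δ = []}     ρ = []
varsAll {Δ = D ∷ Ds} ρ = var (ρ zero) ∷ varsAll (ρ ∘ suc)

subAll-varsAll : ∀ {Γ Δ Ε Ζ} (ρ : Ren Δ Γ) (σ : Sub Γ Ε) (ρ' : Ren Ζ Ε) (M : All (Tm Ζ) Δ) →
                 (∀ {A} (y : Δ ∋ A) → σ (ρ y) ≡ ren ρ' (lookupAll M y)) → subAll σ (varsAll ρ) ≡ renAll ρ' M
subAll-varsAll ρ σ ρ' []       p = refl
subAll-varsAll ρ σ ρ' (m ∷ ms) p = cong₂ _∷_ (p zero) (subAll-varsAll (ρ ∘ suc) σ ρ' ms (p ∘ suc))

sub-apps : ∀ {Γ Δ As} (σ : Sub Γ Δ) (h : Tm Γ [ As ]) (M : All (Tm Γ) As) →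
           sub σ (apps h M) ≡ apps (sub σ h) (subAll σ M)
sub-apps σ h []       = refl
sub-apps σ h (m ∷ ms) = sub-apps σ (app h m) ms

ren-apps : ∀ {Γ Δ As} (ρ : Ren Γ Δ) (h : Tm Γ [ As ]) (M : All (Tm Γ) As) →
           ren ρ (apps h M) ≡ apps (ren ρ h) (renAll ρ M)
ren-apps ρ h []       = refl
ren-apps ρ h (m ∷ ms) = ren-apps ρ (app h m) ms

apps-cong : ∀ {Γ As} {h h' : Tm Γ [ As ]} (M : All (Tm Γ) As) → h ≈ h' → apps h M ≈ apps h' M
apps-cong []       p = p
apps-cong (m ∷ ms) p = apps-cong ms (app-cong p ≈refl)

lams : ∀ {Γ} Δ → Tm (Γ ◂ Δ) o → Tm Γ [ Δ ]
lams []       t = t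
lams (D ∷ Ds) t = lam (lams Ds t)

lams-injective-≈ : ∀ {Γ} Δ {t u : Tm (Γ ◂ Δ) o} → lams Δ t ≈ lams Δ u → t ≈ u
lams-injective-≈ []       p = p
lams-injective-≈ (D ∷ Ds) p = lams-injective-≈ Ds (lam-injective-≈ p)

extS◂ : ∀ {Γ Δ} Ε → Sub Γ Δ → Sub (Γ ◂ Ε) (Δ ◂ Ε)
extS◂ []       σ = σ
extS◂ (D ∷ Ds) σ = extS◂ Ds (extS σ)

sub-lams : ∀ {Γ Δ} Ε (σ : Sub Γ Δ) (t : Tm (Γ ◂ Ε) o) → sub σ (lams Ε t) ≡ lams Ε (sub (extS◂ Ε σ) t)
sub-lams []       σ t = refl
sub-lams (D ∷ Ds) σ t = cong lam (sub-lams Ds (extS σ) t)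

extS◂-wk◂ : ∀ {Γ Δ} Ε (σ : Sub Γ Δ) {A} (x : Γ ∋ A) → extS◂ Ε σ (wk◂ Ε x) ≡ ren (wk◂ Ε) (σ x)
extS◂-wk◂ []       σ x = sym (ren-id (σ x))
extS◂-wk◂ (D ∷ Ds) σ x = trans (extS◂-wk◂ Ds (extS σ) (suc x)) (ren-∘ (wk◂ Ds) suc (σ x))

extS◂-new◂ : ∀ {Γ Δ} Ε (σ : Sub Γ Δ) {A} (y : Ε ∋ A) → extS◂ Ε σ (new◂ Ε y) ≡ var (new◂ Ε y)
extS◂-new◂ (D ∷ Ds) σ zero    = extS◂-wk◂ Ds (extS σ) zero
extS◂-new◂ (D ∷ Ds) σ (suc y) = extS◂-new◂ Ds (extS σ) y

_∷ˢ_ : ∀ {Γ Δ B} → Tm Δ B → Sub Γ Δ → Sub (B ∷ Γ) Δ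
(m ∷ˢ σ) zero    = m
(m ∷ˢ σ) (suc x) = σ x

_◂ˢ_ : ∀ {Γ Δ Ε} → Sub Γ Δ → All (Tm Δ) Ε → Sub (Γ ◂ Ε) Δ
σ ◂ˢ []       = σ
σ ◂ˢ (m ∷ ms) = (m ∷ˢ σ) ◂ˢ ms

◂ˢ-wk◂ : ∀ {Γ Δ Ε} (σ : Sub Γ Δ) (M : All (Tm Δ) Ε) {A} (x : Γ ∋ A) → (σ ◂ˢ M) (wk◂ Ε x) ≡ σ x
◂ˢ-wk◂ σ []       x = refl
◂ˢ-wk◂ σ (m ∷ ms) x = ◂ˢ-wk◂ (m ∷ˢ σ) ms (suc x)

◂ˢ-new◂ : ∀ {Γ Δ Ε} (σ : Sub Γ Δ) (M : All (Tm Δ) Ε) {A} (y : Ε ∋ A) → (σ ◂ˢ M) (new◂ Ε y) ≡ lookupAll M y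
◂ˢ-new◂ σ (m ∷ ms) zero    = ◂ˢ-wk◂ (m ∷ˢ σ) ms zero
◂ˢ-new◂ σ (m ∷ ms) (suc y) = ◂ˢ-new◂ (m ∷ˢ σ) ms y

apps-lams-β : ∀ {Γ Δ} Ε (σ : Sub Γ Δ) (t : Tm (Γ ◂ Ε) o) (M : All (Tm Δ) Ε) →
              apps (sub σ (lams Ε t)) M ≈ sub (σ ◂ˢ M) t
apps-lams-β []       σ t []       = ≈refl
apps-lams-β (B ∷ Bs) σ t (m ∷ ms) =
  ≈trans (apps-cong ms (≈trans (β _ m) (≡⇒≈ contract))) (apps-lams-β Bs (m ∷ˢ σ) t ms)
  where
  contract : (sub (extS σ) (lams Bs t)) [ m ]₀ ≡ sub (m ∷ˢ σ) (lams Bs t)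
  contract = trans (sub-∘ (sub₀ m) (extS σ) (lams Bs t))
                   (sub-cong (λ { zero → refl ; (suc x) → sub₀-wk m (σ x) }) (lams Bs t))

tabulateArgs : ∀ {Γ} (Gs : List Ctx) → (∀ i → Tm Γ [ lookup Gs i ]) → All (Tm Γ) (map [_] Gs)
tabulateArgs []       f = []
tabulateArgs (G ∷ Gs) f = f zero ∷ tabulateArgs Gs (f ∘ suc)

argAt : ∀ {Γ} (Gs : List Ctx) → All (Tm Γ) (map [_] Gs) → (i : Fin (length Gs)) → Tm Γ [ lookup Gs i ]
argAt (G ∷ Gs) (m ∷ ms) zero    = m
argAt (G ∷ Gs) (m ∷ ms) (suc i) = argAt Gs ms i

argAt-tabulate : ∀ {Γ} (Gs : List Ctx) (f : ∀ i → Tm Γ [ lookup Gs i ]) i → argAt Gs (tabulateArgs Gs f) i ≡ f i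
argAt-tabulate (G ∷ Gs) f zero    = refl
argAt-tabulate (G ∷ Gs) f (suc i) = argAt-tabulate Gs (f ∘ suc) i

argAt-subAll : ∀ {Γ Δ} (σ : Sub Γ Δ) (Gs : List Ctx) (M : All (Tm Γ) (map [_] Gs)) i →
               argAt Gs (subAll σ M) i ≡ sub σ (argAt Gs M i)
argAt-subAll σ (G ∷ Gs) (m ∷ ms) zero    = refl
argAt-subAll σ (G ∷ Gs) (m ∷ ms) (suc i) = argAt-subAll σ Gs ms i

argAt-ArgsEq : ∀ {Γ} (Gs : List Ctx) {M N : All (Tm Γ) (map [_] Gs)} → ArgsEq M N → ∀ i → argAt Gs M i ≈ argAt Gs N i
argAt-ArgsEq (G ∷ Gs) (e ∷ es) zero    = e
argAt-ArgsEq (G ∷ Gs) (e ∷ es) (suc i) = argAt-ArgsEq Gs es i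

applyClosed : ∀ {Γ} G Δ → Tm [] [ G ++ Δ ] → Ren Δ Γ → Tm Γ [ G ]
applyClosed G Δ h ρ = lams G (apps (ren (λ ()) h) (varsAll (case++ G (new◂ G) (wk◂ G ∘ ρ))))

SameHeadArgs-args : ∀ {Γ Δ A} {a : Γ ∋ A} {M N : Args Δ A} → SameHeadArgs a M a N → ArgsEq' A M N
SameHeadArgs-args (same _ e) = e

SameHeadArgs-map : ∀ {Γ Γ' Δ} (f : Ren Γ Γ') {A B} {a : Γ ∋ A} {b : Γ ∋ B} {M : Args Δ A} {N : Args Δ B} →
                   SameHeadArgs a M b N → SameHeadArgs (f a) M (f b) N
SameHeadArgs-map f (same a e) = same (f a) e

SameHeadArgs-unmap : ∀ {Γ Γ' Δ} {f : Ren Γ Γ'} → InjectiveRen f →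
                     ∀ {A B} {a : Γ ∋ A} {b : Γ ∋ B} {M : Args Δ A} {N : Args Δ B} →
                     SameHeadArgs (f a) M (f b) N → SameHeadArgs a M b N
SameHeadArgs-unmap {f = f} f-inj s = go s refl refl
  where
  go : ∀ {A B} {a' : _ ∋ A} {b' : _ ∋ B} {M N a b} → SameHeadArgs a' M b' N → a' ≡ f a → b' ≡ f b →
       SameHeadArgs a M b N
  go (same _ e) p q with f-inj (trans (sym p) q)
  ... | refl = same _ e

renAll-injective-≈ : ∀ {Γ Δ As} {ρ : Ren Γ Δ} → InjectiveRen ρ → (M N : All (Tm Γ) As) →
                     ArgsEq (renAll ρ M) (renAll ρ N) → ArgsEq M N
renAll-injective-≈ inj []       []       []       = []
renAll-injective-≈ inj (m ∷ ms) (n ∷ ns) (e ∷ es) = ren-injective-≈ inj e ∷ renAll-injective-≈ inj ms ns es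

SameHeadArgs-renAll⁻ : ∀ {Γ Δ Δ'} {ρ : Ren Δ Δ'} → InjectiveRen ρ →
                       ∀ {As Bs} {a : Γ ∋ [ As ]} {b : Γ ∋ [ Bs ]} (M : Args Δ [ As ]) (N : Args Δ [ Bs ]) →
                       SameHeadArgs a (renAll ρ M) b (renAll ρ N) → SameHeadArgs a M b N
SameHeadArgs-renAll⁻ {ρ = ρ} inj M N s = go s refl refl
  where
  go : ∀ {As Bs} {a : _ ∋ [ As ]} {b : _ ∋ [ Bs ]} {M' N'} {M : Args _ [ As ]} {N : Args _ [ Bs ]} →
       SameHeadArgs a M' b N' → M' ≡ renAll ρ M → N' ≡ renAll ρ N → SameHeadArgs a M b N
  go {M = M} {N} (same a e) refl refl = same a (renAll-injective-≈ inj M N e)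

SameHeadArgs-inl-inr : ∀ Ξ {Γ Δ A B} {x : Ξ ∋ A} {y : Γ ∋ B} {M : Args Δ A} {N : Args Δ B} →
                       ¬ SameHeadArgs (inl x) M (inr Ξ y) N
SameHeadArgs-inl-inr Ξ s = go s refl refl
  where
  go : ∀ {A B} {a : _ ∋ A} {b : _ ∋ B} {M N} {x : Ξ ∋ A} {y : _ ∋ B} →
       SameHeadArgs a M b N → a ≡ inl x → b ≡ inr Ξ y → ⊥
  go (same _ _) p q = inl≢inr Ξ (trans (sym p) q)

apps-≈-heads : ∀ {Γ A B} {u u' : Tm Γ A} {v v' : Tm Γ B} {M N} → u ≡ u' → v ≡ v' →
               apps u M ≈ apps v N → apps u' M ≈ apps v' N
apps-≈-heads refl refl e = e

-- The reduction σ

module Construction (Γ : Ctx) (Γs : List Ctx) (F : Γ ∋ [ map [_] Γs ]) (Θ : Ctx) (k : Fin (length Γs))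
  (inh : ∀ (Δ : Ctx) (t : Θ ∋ [ Δ ]) (i : Fin (length Γs)) → i ≢ k → Inhabited [ lookup Γs i ++ Δ ++ Γ ])
  (ϱ : Sub Θ (Γ ++ lookup Γs k)) (ϱ-atomic : AtomicReduction ϱ) where

  Γₖ : Ctx
  Γₖ = lookup Γs k

  bindΓₖ : ∀ Δ → Ren (Γ ++ Γₖ) ((Γ ◂ Δ) ◂ Γₖ)
  bindΓₖ Δ = case++ Γ (wk◂ Γₖ ∘ wk◂ Δ) (new◂ Γₖ)

  kthArg : ∀ {Δ} → Θ ∋ [ Δ ] → Tm (Γ ◂ Δ) [ Γₖ ]
  kthArg {Δ} t = lams Γₖ (apps (ren (bindΓₖ Δ) (ϱ t)) (varsAll (wk◂ Γₖ ∘ new◂ Δ)))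

  arg : ∀ {Δ} → Θ ∋ [ Δ ] → ∀ i → Tm (Γ ◂ Δ) [ lookup Γs i ]
  arg {Δ} t i with i ≟ k
  ... | yes refl = kthArg t
  ... | no i≢k   = applyClosed (lookup Γs i) (Δ ++ Γ) (inh Δ t i i≢k) (case++ Δ (new◂ Δ) (wk◂ Δ))

  arg-k : ∀ {Δ} (t : Θ ∋ [ Δ ]) → arg t k ≡ kthArg t
  arg-k t with k ≟ k
  ... | yes refl = refl
  ... | no k≢k   = ⊥-elim (k≢k refl)

  σ : Sub Θ Γ
  σ {[ Δ ]} t = lams Δ (apps (var (wk◂ Δ F)) (tabulateArgs Γs (arg t)))

  module Instance (Ξ : Ctx) where

    -- ϱ's atomicity is used with fresh context Ξ, where σ's arguments live in Ξ,Γ,Γₖ via embed,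
    -- while F's k-th argument, once σ is unfolded, lives in (Ξ,Γ) ◂ Γₖ; regroup relates the two.
    embed : Ren (Ξ ++ Γ) (Ξ ++ (Γ ++ Γₖ))
    embed = case++ Ξ inl (inr Ξ ∘ inl)

    regroupΓ,Γₖ : Ren (Γ ++ Γₖ) ((Ξ ++ Γ) ◂ Γₖ)
    regroupΓ,Γₖ = case++ Γ (wk◂ Γₖ ∘ inr Ξ) (new◂ Γₖ)

    regroup : Ren (Ξ ++ (Γ ++ Γₖ)) ((Ξ ++ Γ) ◂ Γₖ)
    regroup = case++ Ξ (wk◂ Γₖ ∘ inl) regroupΓ,Γₖ

    embed-injective : InjectiveRen embed
    embed-injective = case++-injective Ξ (inl-injective Ξ) (inl-injective Γ ∘ inr-injective Ξ)
                                         (λ x y → inl≢inr Ξ)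

    regroup-inr-inl : ∀ {A} (x : Γ ∋ A) → regroup (inr Ξ (inl x)) ≡ wk◂ Γₖ (inr Ξ x)
    regroup-inr-inl x = trans (case++-inr Ξ (wk◂ Γₖ ∘ inl) regroupΓ,Γₖ (inl x))
                              (case++-inl Γ (wk◂ Γₖ ∘ inr Ξ) (new◂ Γₖ) x)

    regroup-inr-inr : ∀ {A} (y : Γₖ ∋ A) → regroup (inr Ξ (inr Γ y)) ≡ new◂ Γₖ y
    regroup-inr-inr y = trans (case++-inr Ξ (wk◂ Γₖ ∘ inl) regroupΓ,Γₖ (inr Γ y))
                              (case++-inr Γ (wk◂ Γₖ ∘ inr Ξ) (new◂ Γₖ) y)

    regroup-injective : InjectiveRen regroup
    regroup-injective = case++-injective Ξ (inl-injective Ξ ∘ wk◂-injective Γₖ) regroupΓ,Γₖ-injective inl≢Γ,Γₖ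
      where
      regroupΓ,Γₖ-injective : InjectiveRen regroupΓ,Γₖ
      regroupΓ,Γₖ-injective = case++-injective Γ (inr-injective Ξ ∘ wk◂-injective Γₖ) (new◂-injective Γₖ)
                                                 (λ x y → wk◂≢new◂ Γₖ (inr Ξ x) y)
      inl≢Γ,Γₖ : ∀ {A} (x : Ξ ∋ A) (w : (Γ ++ Γₖ) ∋ A) → wk◂ Γₖ (inl x) ≢ regroupΓ,Γₖ w
      inl≢Γ,Γₖ x w p with view++ Γ w
      ... | is-inl y = inl≢inr Ξ (wk◂-injective Γₖ (trans p (case++-inl Γ (wk◂ Γₖ ∘ inr Ξ) (new◂ Γₖ) y)))
      ... | is-inr y = wk◂≢new◂ Γₖ (inl x) y (trans p (case++-inr Γ (wk◂ Γₖ ∘ inr Ξ) (new◂ Γₖ) y))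

    regroup-embed : ∀ {A} (v : (Ξ ++ Γ) ∋ A) → regroup (embed v) ≡ wk◂ Γₖ v
    regroup-embed v with view++ Ξ v
    ... | is-inl x = trans (cong regroup (case++-inl Ξ inl (inr Ξ ∘ inl) x))
                           (case++-inl Ξ (wk◂ Γₖ ∘ inl) regroupΓ,Γₖ x)
    ... | is-inr x = trans (cong regroup (case++-inr Ξ inl (inr Ξ ∘ inl) x)) (regroup-inr-inl x)

    env : ∀ {Δ} → All (Tm (Ξ ++ Γ)) Δ → Sub (Γ ◂ Δ) (Ξ ++ Γ)
    env M = (var ∘ inr Ξ) ◂ˢ M

    F-args : ∀ {Δ} → Θ ∋ [ Δ ] → All (Tm (Ξ ++ Γ)) Δ → All (Tm (Ξ ++ Γ)) (map [_] Γs)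
    F-args t M = subAll (env M) (tabulateArgs Γs (arg t))

    ϱ-app : ∀ {Δ} → Θ ∋ [ Δ ] → All (Tm (Ξ ++ Γ)) Δ → Tm (Ξ ++ (Γ ++ Γₖ)) o
    ϱ-app t M = apps (ren (inr Ξ) (ϱ t)) (renAll embed M)

    σ-unfold : ∀ {Δ} (t : Θ ∋ [ Δ ]) (M : All (Tm (Ξ ++ Γ)) Δ) →
               apps (ren (inr Ξ) (σ t)) M ≈ apps (var (inr Ξ F)) (F-args t M)
    σ-unfold {Δ} t M = begin
      apps (ren (inr Ξ) (σ t)) M                     ≡⟨ cong (λ s → apps s M) (ren-as-sub (inr Ξ) (σ t)) ⟩
      apps (sub (var ∘ inr Ξ) (σ t)) M               ≈⟨ apps-lams-β Δ (var ∘ inr Ξ) _ M ⟩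
      sub (env M) (apps (var (wk◂ Δ F)) Ns)          ≡⟨ sub-apps (env M) (var (wk◂ Δ F)) Ns ⟩
      apps (env M (wk◂ Δ F)) (subAll (env M) Ns)     ≡⟨ cong (λ s → apps s (F-args t M)) (◂ˢ-wk◂ _ M F) ⟩
      apps (var (inr Ξ F)) (F-args t M)              ∎
      where
      open SetoidReasoning (≈-setoid _ _)
      Ns : All (Tm (Γ ◂ Δ)) (map [_] Γs)
      Ns = tabulateArgs Γs (arg t)

    env◂-bindΓₖ : ∀ {Δ} (M : All (Tm (Ξ ++ Γ)) Δ) {A} (z : (Γ ++ Γₖ) ∋ A) →
                  extS◂ Γₖ (env M) (bindΓₖ Δ z) ≡ var (regroup (inr Ξ z))
    env◂-bindΓₖ {Δ} M z with view++ Γ z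
    ... | is-inl x = begin
      extS◂ Γₖ (env M) (bindΓₖ Δ (inl x))     ≡⟨ cong (extS◂ Γₖ (env M)) (case++-inl Γ (wk◂ Γₖ ∘ wk◂ Δ) (new◂ Γₖ) x) ⟩
      extS◂ Γₖ (env M) (wk◂ Γₖ (wk◂ Δ x))     ≡⟨ extS◂-wk◂ Γₖ (env M) (wk◂ Δ x) ⟩
      ren (wk◂ Γₖ) (env M (wk◂ Δ x))          ≡⟨ cong (ren (wk◂ Γₖ)) (◂ˢ-wk◂ (var ∘ inr Ξ) M x) ⟩
      var (wk◂ Γₖ (inr Ξ x))                  ≡⟨ cong var (regroup-inr-inl x) ⟨
      var (regroup (inr Ξ (inl x)))           ∎
      where open ≡-Reasoning
    ... | is-inr y = begin
      extS◂ Γₖ (env M) (bindΓₖ Δ (inr Γ y))   ≡⟨ cong (extS◂ Γₖ (env M)) (case++-inr Γ (wk◂ Γₖ ∘ wk◂ Δ) (new◂ Γₖ) y) ⟩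
      extS◂ Γₖ (env M) (new◂ Γₖ y)            ≡⟨ extS◂-new◂ Γₖ (env M) y ⟩
      var (new◂ Γₖ y)                         ≡⟨ cong var (regroup-inr-inr y) ⟨
      var (regroup (inr Ξ (inr Γ y)))         ∎
      where open ≡-Reasoning

    env◂-Δ : ∀ {Δ} (M : All (Tm (Ξ ++ Γ)) Δ) {A} (y : Δ ∋ A) →
             extS◂ Γₖ (env M) (wk◂ Γₖ (new◂ Δ y)) ≡ ren (regroup ∘ embed) (lookupAll M y)
    env◂-Δ {Δ} M y = begin
      extS◂ Γₖ (env M) (wk◂ Γₖ (new◂ Δ y))    ≡⟨ extS◂-wk◂ Γₖ (env M) (new◂ Δ y) ⟩
      ren (wk◂ Γₖ) (env M (new◂ Δ y))         ≡⟨ cong (ren (wk◂ Γₖ)) (◂ˢ-new◂ (var ∘ inr Ξ) M y) ⟩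
      ren (wk◂ Γₖ) (lookupAll M y)            ≡⟨ ren-cong (sym ∘ regroup-embed) (lookupAll M y) ⟩
      ren (regroup ∘ embed) (lookupAll M y)   ∎
      where open ≡-Reasoning

    kthArg-env : ∀ {Δ} (t : Θ ∋ [ Δ ]) (M : All (Tm (Ξ ++ Γ)) Δ) →
                 sub (env M) (kthArg t) ≡ lams Γₖ (ren regroup (ϱ-app t M))
    kthArg-env {Δ} t M = begin
      sub (env M) (kthArg t)                                              ≡⟨ sub-lams Γₖ (env M) _ ⟩
      lams Γₖ (sub T (apps (ren (bindΓₖ Δ) (ϱ t)) vars))                  ≡⟨ cong (lams Γₖ) (sub-apps T _ vars) ⟩
      lams Γₖ (apps (sub T (ren (bindΓₖ Δ) (ϱ t))) (subAll T vars))       ≡⟨ cong (lams Γₖ) (cong₂ apps head-eq args-eq) ⟩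
      lams Γₖ (apps (ren regroup (ren (inr Ξ) (ϱ t))) (renAll regroup (renAll embed M)))
                                                                          ≡⟨ cong (lams Γₖ) (ren-apps regroup _ (renAll embed M)) ⟨
      lams Γₖ (ren regroup (ϱ-app t M))                                   ∎
      where
      open ≡-Reasoning
      T : Sub ((Γ ◂ Δ) ◂ Γₖ) ((Ξ ++ Γ) ◂ Γₖ)
      T = extS◂ Γₖ (env M)
      vars : All (Tm ((Γ ◂ Δ) ◂ Γₖ)) Δ
      vars = varsAll (wk◂ Γₖ ∘ new◂ Δ)
      head-eq : sub T (ren (bindΓₖ Δ) (ϱ t)) ≡ ren regroup (ren (inr Ξ) (ϱ t))
      head-eq = begin
        sub T (ren (bindΓₖ Δ) (ϱ t))           ≡⟨ sub-ren T (bindΓₖ Δ) (ϱ t) ⟩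
        sub (T ∘ bindΓₖ Δ) (ϱ t)               ≡⟨ sub-cong (env◂-bindΓₖ M) (ϱ t) ⟩
        sub (var ∘ regroup ∘ inr Ξ) (ϱ t)      ≡⟨ ren-as-sub (regroup ∘ inr Ξ) (ϱ t) ⟨
        ren (regroup ∘ inr Ξ) (ϱ t)            ≡⟨ ren-∘ regroup (inr Ξ) (ϱ t) ⟨
        ren regroup (ren (inr Ξ) (ϱ t))        ∎
      args-eq : subAll T vars ≡ renAll regroup (renAll embed M)
      args-eq = trans (subAll-varsAll _ T (regroup ∘ embed) M (env◂-Δ M)) (sym (renAll-∘ regroup embed M))

    kthArg-σ-unfold : ∀ {Δ} (t : Θ ∋ [ Δ ]) (M : All (Tm (Ξ ++ Γ)) Δ) →
                      argAt Γs (F-args t M) k ≡ lams Γₖ (ren regroup (ϱ-app t M))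
    kthArg-σ-unfold t M = begin
      argAt Γs (F-args t M) k                              ≡⟨ argAt-subAll (env M) Γs _ k ⟩
      sub (env M) (argAt Γs (tabulateArgs Γs (arg t)) k)   ≡⟨ cong (sub (env M)) (argAt-tabulate Γs (arg t) k) ⟩
      sub (env M) (arg t k)                                ≡⟨ cong (sub (env M)) (arg-k t) ⟩
      sub (env M) (kthArg t)                               ≡⟨ kthArg-env t M ⟩
      lams Γₖ (ren regroup (ϱ-app t M))                    ∎
      where open ≡-Reasoning

    var≉σ : ∀ {A B} (x : Ξ ∋ A) (t : Θ ∋ B) (M : Args (Ξ ++ Γ) A) (N : Args (Ξ ++ Γ) B) →
            ¬ apps (var (inl x)) M ≈ apps (ren (inr Ξ) (σ t)) N
    var≉σ {B = [ Δ ]} x t M N e =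
      SameHeadArgs-inl-inr Ξ (apps-var-injective (inl x) (inr Ξ F) M _ (≈trans e (σ-unfold t N)))

    σ-heads : ∀ {A B} (s : Θ ∋ A) (t : Θ ∋ B) (M : Args (Ξ ++ Γ) A) (N : Args (Ξ ++ Γ) B) →
              apps (ren (inr Ξ) (σ s)) M ≈ apps (ren (inr Ξ) (σ t)) N → SameHeadArgs (inr Ξ s) M (inr Ξ t) N
    σ-heads {[ Δ ]} {[ Δ' ]} s t M N e =
      SameHeadArgs-renAll⁻ embed-injective M N
        (ϱ-atomic Ξ (inr Ξ s) (inr Ξ t) (renAll embed M) (renAll embed N)
          (apps-≈-heads (sym (lift-inr Ξ ϱ s)) (sym (lift-inr Ξ ϱ t)) ϱ-equation))
      where
      F-args-≈ : ArgsEq (F-args s M) (F-args t N)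
      F-args-≈ = SameHeadArgs-args (apps-var-injective (inr Ξ F) (inr Ξ F) _ _
                   (≈trans (≈sym (σ-unfold s M)) (≈trans e (σ-unfold t N))))
      kth-≈ : lams Γₖ (ren regroup (ϱ-app s M)) ≈ lams Γₖ (ren regroup (ϱ-app t N))
      kth-≈ = subst₂ _≈_ (kthArg-σ-unfold s M) (kthArg-σ-unfold t N) (argAt-ArgsEq Γs F-args-≈ k)
      ϱ-equation : ϱ-app s M ≈ ϱ-app t N
      ϱ-equation = ren-injective-≈ regroup-injective (lams-injective-≈ Γₖ kth-≈)

  σ-atomic : AtomicReduction σ
  σ-atomic Ξ a b M N e with view++ Ξ a | view++ Ξ b
  ... | is-inl x | is-inl y = SameHeadArgs-map inl (SameHeadArgs-unmap (inl-injective Ξ)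
        (apps-var-injective (inl x) (inl y) M N (apps-≈-heads (lift-inl Ξ σ x) (lift-inl Ξ σ y) e)))
  ... | is-inl x | is-inr t = ⊥-elim (Instance.var≉σ Ξ x t M N
        (apps-≈-heads (lift-inl Ξ σ x) (lift-inr Ξ σ t) e))
  ... | is-inr s | is-inl y = ⊥-elim (Instance.var≉σ Ξ y s N M
        (≈sym (apps-≈-heads (lift-inr Ξ σ s) (lift-inl Ξ σ y) e)))
  ... | is-inr s | is-inr t = Instance.σ-heads Ξ s t M N
        (apps-≈-heads (lift-inr Ξ σ s) (lift-inr Ξ σ t) e)

lemmaL : (Γ : Ctx) (Γs : List Ctx) (F : Γ ∋ [ map [_] Γs ])
         (Θ : Ctx) (k : Fin (length Γs)) →
         (∀ (Δ : Ctx) (t : Θ ∋ [ Δ ]) (i : Fin (length Γs)) → i ≢ k →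
            Inhabited [ lookup Γs i ++ Δ ++ Γ ]) →
         Θ ≤ᵃ (Γ ++ lookup Γs k) → Θ ≤ᵃ Γ
lemmaL Γ Γs F Θ k inh (ϱ , ϱ-atomic) = σ , σ-atomic
  where open Construction Γ Γs F Θ k inh ϱ ϱ-atomic
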